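{- Let $\mathcal{C}$ be a cd-category with effect conditioning and let $\mathcal{M}$ be a causal model in $\mathcal{C}$ with DAG $G$, variables $V$, outputs $O$ and mechanisms $(c_Y)_{Y\in V}$. Let $X\in V$ with $\{X\}\cup\mathrm{Pa}(X)\subseteq O$, and let $\omega$ be the output state of $\mathcal{M}$. If $\omega$ has full support over $\mathrm{Pa}(X)$, then $c_X=\omega_{X|\mathrm{Pa}(X)}$ as morphisms $X_{\mathrm{Pa}(X)}\to X$.
   Context: A cd-category is a symmetric monoidal category $(\mathcal{C},\otimes,I)$ (symmetry $\sigma$) in which every object $X$ carries $\Delta_X\colon X\to X\otimes X$ and $\epsilon_X\colon X\to I$ forming a commutative comonoid, compatible with the tensor. A channel is $f\colon X\to Y$ with $\epsilon_Y\circ f=\epsilon_X$; a partial channel is $f$ with $f=(f\otimes(\epsilon_Y\circ f))\circ\Delta_X$. Effect conditioning: $\mathcal{C}$ has (i) normalisation: a partial channel $\mathrm{norm}(f)$ for each $f\colon X\to Y$ with $f=(\mathrm{norm}(f)\otimes(\epsilon_Y\circ f))\circ\Delta_X$, $\mathrm{norm}(f)=f$ for partial channels, $\mathrm{norm}(f\otimes g)=\mathrm{norm}(f)\otimes\mathrm{norm}(g)$, $\mathrm{norm}(\epsilon\circ f)=\epsilon\circ\mathrm{norm}(f)$, $\mathrm{norm}(f\circ\Delta_X)=\mathrm{norm}(f)\circ\Delta_X$ for $f\colon X\otimes X\to Y$; (ii) cancellative caps: effects $\cap_X\colon X\otimes X\to I$ that are symmetric, satisfy $\cap_X\circ\Delta_X=\epsilon_X$,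 $(\cap_X\otimes\mathrm{id})\circ(\mathrm{id}\otimes\Delta_X)=(\mathrm{id}\otimes\cap_X)\circ(\Delta_X\otimes\mathrm{id})$, are compatible with $\otimes$, and such that $(\mathrm{id}_B\otimes\cap_X)\circ(f\otimes\mathrm{id}_X)=(\mathrm{id}_B\otimes\cap_X)\circ(g\otimes\mathrm{id}_X)$ implies $f=g$ for $f,g\colon A\to B\otimes X$. Causal model: a finite DAG $G$ on a vertex set $V$, a subset $O\subseteq V$ of outputs, an object of $\mathcal{C}$ for each vertex (same name), and for each $Y\in V$ a channel $c_Y\colon X_{\mathrm{Pa}(Y)}\to Y$ (mechanism), where $X_S=\bigotimes_{Z\in S}Z$ and $\mathrm{Pa}(Y)$ are the parents of $Y$ in $G$. The state over all variables: for a topological order $X_1,\dots,X_n$ of $V$, $\omega_0=\mathrm{id}_I$, $\omega_k=(\mathrm{id}\otimes(c_{X_k}\circ\pi_k))\circ\Delta_{X_1\otimes\cdots\otimes X_{k-1}}\circ\omega_{k-1}$ with $\pi_k$ discarding non-parents; the output state $\omega$ is the marginal of $\omega_n$ on $O$. Marginals/conditionals: for $S\subseteq O$, $\omega_S$ is the marginal on $X_S$; for disjoint $S,T$, $\omega_{S|T}:=\mathrm{norm}((\mathrm{id}_{X_S}\otimes\cap_{X_T})\circ(\omega_{S\cup T}\otimes\mathrm{id}_{X_T}))\colon X_T\to X_S$ (with $\omega_{S\cup T}$ regarded as a state of $X_S\otimes X_T$). $\omega$ has full support over $S$ if $\mathrm{norm}(\cap_{X_S}\circ(\omega_S\otimes\mathrm{id}_{X_S}))=\epsilon_{X_S}$.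 -}

module Defs where

open import Level using (Level; _⊔_) renaming (suc to lsuc)
open import Data.Nat using (ℕ; zero; suc)
open import Data.Fin using (Fin; zero; suc)
open import Data.Bool using (Bool; true; false; _∨_)
open import Data.Bool.Properties using (∨-zeroʳ)
open import Data.Empty using (⊥; ⊥-elim)
open import Relation.Binary.PropositionalEquality

record SymMonCat (o ℓ : Level) : Set (lsuc (o ⊔ ℓ)) where
  infixr 9 _∘_
  infixr 10 _⊗₀_ _⊗₁_
  infix 4 _⇒_
  field
    Obj : Set o
    _⇒_ : Obj → Obj → Set ℓ
    id  : ∀ {A} → A ⇒ A
    _∘_ : ∀ {A B C} → B ⇒ C → A ⇒ B → A ⇒ C
    assoc     : ∀ {A B C D} {f : A ⇒ B} {g : B ⇒ C} {h : C ⇒ D} →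
                (h ∘ g) ∘ f ≡ h ∘ (g ∘ f)
    identityˡ : ∀ {A B} {f : A ⇒ B} → id ∘ f ≡ f
    identityʳ : ∀ {A B} {f : A ⇒ B} → f ∘ id ≡ f

    _⊗₀_ : Obj → Obj → Obj
    _⊗₁_ : ∀ {A B C D} → A ⇒ B → C ⇒ D → A ⊗₀ C ⇒ B ⊗₀ D
    ⊗-id : ∀ {A B} → id {A} ⊗₁ id {B} ≡ id
    ⊗-∘  : ∀ {A B C D E F} {f : B ⇒ C} {g : A ⇒ B} {h : E ⇒ F} {k : D ⇒ E} →
           (f ∘ g) ⊗₁ (h ∘ k) ≡ (f ⊗₁ h) ∘ (g ⊗₁ k)
    unit : Obj

    α⇒ : ∀ {A B C} → (A ⊗₀ B) ⊗₀ C ⇒ A ⊗₀ (B ⊗₀ C)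
    α⇐ : ∀ {A B C} → A ⊗₀ (B ⊗₀ C) ⇒ (A ⊗₀ B) ⊗₀ C
    α-iso₁ : ∀ {A B C} → α⇒ {A} {B} {C} ∘ α⇐ ≡ id
    α-iso₂ : ∀ {A B C} → α⇐ {A} {B} {C} ∘ α⇒ ≡ id
    α-nat  : ∀ {A B C D E F} {f : A ⇒ D} {g : B ⇒ E} {h : C ⇒ F} →
             α⇒ ∘ ((f ⊗₁ g) ⊗₁ h) ≡ (f ⊗₁ (g ⊗₁ h)) ∘ α⇒

    λ⇒ : ∀ {A} → unit ⊗₀ A ⇒ A
    λ⇐ : ∀ {A} → A ⇒ unit ⊗₀ A
    λ-iso₁ : ∀ {A} → λ⇒ {A} ∘ λ⇐ ≡ id
    λ-iso₂ : ∀ {A} → λ⇐ {A} ∘ λ⇒ ≡ id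
    λ-nat  : ∀ {A B} {f : A ⇒ B} → λ⇒ ∘ (id ⊗₁ f) ≡ f ∘ λ⇒

    ρ⇒ : ∀ {A} → A ⊗₀ unit ⇒ A
    ρ⇐ : ∀ {A} → A ⇒ A ⊗₀ unit
    ρ-iso₁ : ∀ {A} → ρ⇒ {A} ∘ ρ⇐ ≡ id
    ρ-iso₂ : ∀ {A} → ρ⇐ {A} ∘ ρ⇒ ≡ id
    ρ-nat  : ∀ {A B} {f : A ⇒ B} → ρ⇒ ∘ (f ⊗₁ id) ≡ f ∘ ρ⇒

    triangle : ∀ {A B} → (id {A} ⊗₁ λ⇒ {B}) ∘ α⇒ ≡ ρ⇒ ⊗₁ id
    pentagon : ∀ {A B C D} →
               (id {A} ⊗₁ α⇒ {B} {C} {D}) ∘ α⇒ ∘ (α⇒ ⊗₁ id) ≡ α⇒ ∘ α⇒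

    σ : ∀ {A B} → A ⊗₀ B ⇒ B ⊗₀ A
    σ-nat : ∀ {A B C D} {f : A ⇒ C} {g : B ⇒ D} → σ ∘ (f ⊗₁ g) ≡ (g ⊗₁ f) ∘ σ
    σ-inv : ∀ {A B} → σ {B} {A} ∘ σ {A} {B} ≡ id
    hexagon : ∀ {A B C} →
              (id {B} ⊗₁ σ {A} {C}) ∘ α⇒ ∘ (σ ⊗₁ id) ≡ α⇒ ∘ σ ∘ α⇒

  interchange : ∀ {A B C D} → (A ⊗₀ B) ⊗₀ (C ⊗₀ D) ⇒ (A ⊗₀ C) ⊗₀ (B ⊗₀ D)
  interchange = α⇐ ∘ (id ⊗₁ (α⇒ ∘ (σ ⊗₁ id) ∘ α⇐)) ∘ α⇒

record IsCD {o ℓ} (C : SymMonCat o ℓ) : Set (o ⊔ ℓ) where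
  open SymMonCat C
  field
    Δ : ∀ {A} → A ⇒ A ⊗₀ A
    ε : ∀ {A} → A ⇒ unit
    counitˡ : ∀ {A} → (ε ⊗₁ id) ∘ Δ ≡ λ⇐ {A}
    counitʳ : ∀ {A} → (id ⊗₁ ε) ∘ Δ ≡ ρ⇐ {A}
    coassoc : ∀ {A} → α⇒ ∘ (Δ ⊗₁ id) ∘ Δ ≡ (id ⊗₁ Δ) ∘ Δ {A}
    cocomm  : ∀ {A} → σ ∘ Δ ≡ Δ {A}
    Δ-⊗ : ∀ {A B} → Δ {A ⊗₀ B} ≡ interchange ∘ (Δ ⊗₁ Δ)
    ε-⊗ : ∀ {A B} → ε {A ⊗₀ B} ≡ λ⇒ ∘ (ε ⊗₁ ε)
    Δ-unit : Δ {unit} ≡ λ⇐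
    ε-unit : ε {unit} ≡ id

  IsChannel : ∀ {A B} → A ⇒ B → Set ℓ
  IsChannel f = ε ∘ f ≡ ε

  IsPartialChannel : ∀ {A B} → A ⇒ B → Set ℓ
  IsPartialChannel f = f ≡ ρ⇒ ∘ (f ⊗₁ (ε ∘ f)) ∘ Δ

record EffectConditioning {o ℓ} (C : SymMonCat o ℓ) (D : IsCD C) : Set (o ⊔ ℓ) where
  open SymMonCat C
  open IsCD D
  field
    norm : ∀ {A B} → A ⇒ B → A ⇒ B
    norm-partial : ∀ {A B} (f : A ⇒ B) → IsPartialChannel (norm f)
    norm-decomp  : ∀ {A B} (f : A ⇒ B) → f ≡ ρ⇒ ∘ (norm f ⊗₁ (ε ∘ f)) ∘ Δ
    norm-fix     : ∀ {A B} (f : A ⇒ B) → IsPartialChannel f → norm f ≡ f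
    norm-⊗ : ∀ {A B C' D'} (f : A ⇒ B) (g : C' ⇒ D') →
             norm (f ⊗₁ g) ≡ norm f ⊗₁ norm g
    norm-ε : ∀ {A B} (f : A ⇒ B) → norm (ε ∘ f) ≡ ε ∘ norm f
    norm-Δ : ∀ {A B} (f : A ⊗₀ A ⇒ B) → norm (f ∘ Δ) ≡ norm f ∘ Δ

    cap : ∀ {A} → A ⊗₀ A ⇒ unit
    cap-sym : ∀ {A} → cap {A} ∘ σ ≡ cap
    cap-Δ   : ∀ {A} → cap {A} ∘ Δ ≡ ε
    cap-frobenius : ∀ {A} →
      λ⇒ ∘ (cap {A} ⊗₁ id) ∘ α⇐ ∘ (id ⊗₁ Δ) ≡ ρ⇒ ∘ (id ⊗₁ cap {A}) ∘ α⇒ ∘ (Δ ⊗₁ id)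
    cap-⊗ : ∀ {A B} → cap {A ⊗₀ B} ≡ λ⇒ ∘ (cap ⊗₁ cap) ∘ interchange
    cap-cancel : ∀ {A B X} (f g : A ⇒ B ⊗₀ X) →
      ρ⇒ ∘ (id ⊗₁ cap {X}) ∘ α⇒ ∘ (f ⊗₁ id) ≡ ρ⇒ ∘ (id ⊗₁ cap {X}) ∘ α⇒ ∘ (g ⊗₁ id) →
      f ≡ g

_⊆_ : ∀ {n} → (Fin n → Bool) → (Fin n → Bool) → Set
S ⊆ T = ∀ i → S i ≡ true → T i ≡ true

_∪_ : ∀ {n} → (Fin n → Bool) → (Fin n → Bool) → (Fin n → Bool)
(S ∪ T) i = S i ∨ T i

Disjoint : ∀ {n} → (Fin n → Bool) → (Fin n → Bool) → Set
Disjoint S T = ∀ i → S i ≡ true → T i ≡ true → ⊥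

full : ∀ {n} → Fin n → Bool
full _ = true

single : ∀ {n} → Fin n → Fin n → Bool
single zero    zero    = true
single zero    (suc _) = false
single (suc j) zero    = false
single (suc j) (suc i) = single j i

∪-⊆ʳ : ∀ {n} {S T U : Fin n → Bool} → (S ∪ T) ⊆ U → T ⊆ U
∪-⊆ʳ {S = S} p i q = p i (trans (cong (S i ∨_) q) (∨-zeroʳ (S i)))

single-eq : ∀ {n} (j i : Fin n) → single j i ≡ true → i ≡ j
single-eq zero    zero    _ = refl
single-eq zero    (suc i) ()
single-eq (suc j) zero    ()
single-eq (suc j) (suc i) p = cong suc (single-eq j i p)

module Causal {o ℓ} (C : SymMonCat o ℓ) (D : IsCD C) where
  open SymMonCat C
  open IsCD D

  step : Bool → Obj → Obj → Obj
  step true  A X = A ⊗₀ X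
  step false A X = A

  -- X_S : tensor of the objects in S, in index order
  -- (X_S = (...((I ⊗ X_{i_k}) ⊗ ...) ⊗ X_{i_1}) for S = {i_1 < ... < i_k}).
  X[_] : ∀ {n} → (Fin n → Bool) → (Fin n → Obj) → Obj
  X[_] {zero}  S ob = unit
  X[_] {suc n} S ob = step (S zero) (X[ (λ i → S (suc i)) ] (λ i → ob (suc i))) (ob zero)

  margStep : ∀ {A B X} (s t : Bool) → (s ≡ true → t ≡ true) →
             A ⇒ B → step t A X ⇒ step s B X
  margStep true  true  _ f = f ⊗₁ id
  margStep true  false p f with p refl
  ... | ()
  margStep false true  _ f = ρ⇒ ∘ (f ⊗₁ ε)
  margStep false false _ f = f

  marg : ∀ {n} {ob : Fin n → Obj} (S T : Fin n → Bool) → S ⊆ T →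
         X[ T ] ob ⇒ X[ S ] ob
  marg {zero}  S T p = id
  marg {suc n} S T p =
    margStep (S zero) (T zero) (p zero)
      (marg (λ i → S (suc i)) (λ i → T (suc i)) (λ i → p (suc i)))

  splitStep : ∀ {U A B X} (s t : Bool) → (s ≡ true → t ≡ true → ⊥) →
              U ⇒ A ⊗₀ B → step (s ∨ t) U X ⇒ step s A X ⊗₀ step t B X
  splitStep true  true  d f = ⊥-elim (d refl refl)
  splitStep true  false d f = α⇐ ∘ (id ⊗₁ σ) ∘ α⇒ ∘ (f ⊗₁ id)
  splitStep false true  d f = α⇒ ∘ (f ⊗₁ id)
  splitStep false false d f = f

  split : ∀ {n} {ob : Fin n → Obj} (S T : Fin n → Bool) → Disjoint S T →
          X[ S ∪ T ] ob ⇒ X[ S ] ob ⊗₀ X[ T ] ob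
  split {zero}  S T d = λ⇐
  split {suc n} S T d =
    splitStep (S zero) (T zero) (d zero)
      (split (λ i → S (suc i)) (λ i → T (suc i)) (λ i → d (suc i)))

  empty⇒unit : ∀ {n} (ob : Fin n → Obj) → X[ (λ _ → false) ] ob ⇒ unit
  empty⇒unit {zero}  ob = id
  empty⇒unit {suc n} ob = empty⇒unit (λ i → ob (suc i))

  unsingle : ∀ {n} {ob : Fin n → Obj} (j : Fin n) → X[ single j ] ob ⇒ ob j
  unsingle {suc n} {ob} zero = λ⇒ ∘ (empty⇒unit (λ i → ob (suc i)) ⊗₁ id)
  unsingle {suc n} (suc j) = unsingle j

  -- A DAG on Fin n with vertices numbered in REVERSE topological order
  -- (vertex zero is the last one; every parent of a vertex has a larger
  -- index), together with a mechanism (a channel) for each vertex.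
  -- `snoc M pa c ch` adds a new vertex (index zero) with parent set pa among
  -- the previous vertices and mechanism c : X_{pa} → X.
  data Mechanisms : (n : ℕ) → (Fin n → Obj) → Set (o ⊔ ℓ) where
    []   : ∀ {ob} → Mechanisms zero ob
    snoc : ∀ {n} {ob : Fin (suc n) → Obj} →
           Mechanisms n (λ i → ob (suc i)) →
           (pa : Fin n → Bool) →
           (c : X[ pa ] (λ i → ob (suc i)) ⇒ ob zero) →
           IsChannel c →
           Mechanisms (suc n) ob

  -- Pa j i : i is a parent of j in G
  Pa : ∀ {n ob} → Mechanisms n ob → Fin n → Fin n → Bool
  Pa (snoc M pa c _) zero    zero    = false
  Pa (snoc M pa c _) zero    (suc i) = pa i
  Pa (snoc M pa c _) (suc j) zero    = false
  Pa (snoc M pa c _) (suc j) (suc i) = Pa M j i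

  mech : ∀ {n ob} (M : Mechanisms n ob) (j : Fin n) → X[ Pa M j ] ob ⇒ ob j
  mech (snoc M pa c _) zero    = c
  mech (snoc M pa c _) (suc j) = mech M j

  Pa-irrefl : ∀ {n ob} (M : Mechanisms n ob) (j : Fin n) → Pa M j j ≡ false
  Pa-irrefl (snoc M pa c _) zero    = refl
  Pa-irrefl (snoc M pa c _) (suc j) = Pa-irrefl M j

  single-Pa-disjoint : ∀ {n ob} (M : Mechanisms n ob) (j : Fin n) →
                       Disjoint (single j) (Pa M j)
  single-Pa-disjoint M j i p q with single-eq j i p
  ... | refl with trans (sym q) (Pa-irrefl M j)
  ...   | ()

  joint : ∀ {n ob} → Mechanisms n ob → unit ⇒ X[ full ] ob
  joint [] = id
  joint (snoc M pa c _) = (id ⊗₁ (c ∘ marg pa full (λ _ _ → refl))) ∘ Δ ∘ joint M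

  record CausalModel : Set (o ⊔ ℓ) where
    field
      n     : ℕ
      ob    : Fin n → Obj
      mechs : Mechanisms n ob
      out   : Fin n → Bool

module Conditioning {o ℓ} (C : SymMonCat o ℓ) (D : IsCD C)
                    (E : EffectConditioning C D)
                    (M : Causal.CausalModel C D) where
  open SymMonCat C
  open IsCD D
  open EffectConditioning E
  open Causal C D
  open CausalModel M

  ω : unit ⇒ X[ out ] ob
  ω = marg out full (λ _ _ → refl) ∘ joint mechs

  marginal : (S : Fin n → Bool) → S ⊆ out → unit ⇒ X[ S ] ob
  marginal S p = marg S out p ∘ ω

  cond : (S T : Fin n → Bool) → Disjoint S T → (S ∪ T) ⊆ out →
         X[ T ] ob ⇒ X[ S ] ob
  cond S T d p =
    norm (ρ⇒ ∘ (id ⊗₁ cap) ∘ α⇒ ∘ ((split S T d ∘ marginal (S ∪ T) p) ⊗₁ id) ∘ λ⇐)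

  FullSupport : (S : Fin n → Bool) → S ⊆ out → Set ℓ
  FullSupport S p = norm (cap ∘ (marginal S p ⊗₁ id) ∘ λ⇐) ≡ ε

  Parents : Fin n → Fin n → Bool
  Parents = Pa mechs

  c : (x : Fin n) → X[ Parents x ] ob ⇒ ob x
  c = mech mechs

module Submission where

-- Induction on the vertex, numbered so that the newest vertex comes first.  Discarding a
-- later vertex, which is produced by a channel, does not change the marginals involved, so
-- only the newest vertex x matters.  There the joint state of (x, Pa x) is the graph
-- (c ⊗ id) ∘ Δ ∘ q of the mechanism c over q = ω_{Pa x}.  Bending the second leg of that
-- graph with a cap and using the Frobenius law yields λ⇒ ∘ (w ⊗ c) ∘ Δ, where the effect
-- w = cap ∘ (q ⊗ id) ∘ λ⇐ records how likely each input is; normalisation replaces w by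
-- norm w, which is the discard ε precisely because q has full support.  What remains is c.

open import Defs
open import Data.Fin using (Fin; zero; suc)
open import Data.Nat using (zero; suc)
open import Data.Bool using (Bool; true; false)
open import Data.Empty using (⊥)
open import Relation.Binary.PropositionalEquality

module Monoidal {o ℓ} (C : SymMonCat o ℓ) where
  open SymMonCat C
  open ≡-Reasoning

  pullˡ : ∀ {A B B' X} {a : B ⇒ B'} {b : A ⇒ B} {c : A ⇒ B'} {f : X ⇒ A} →
          a ∘ b ≡ c → a ∘ (b ∘ f) ≡ c ∘ f
  pullˡ eq = trans (sym assoc) (cong (_∘ _) eq)

  cancelʳ : ∀ {A B B'} {a : B ⇒ B'} {i : A ⇒ B} {j : B ⇒ A} → i ∘ j ≡ id → (a ∘ i) ∘ j ≡ a
  cancelʳ {a = a} eq = trans assoc (trans (cong (a ∘_) eq) identityʳ)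

  cancelˡ : ∀ {A B B'} {a : A ⇒ B'} {i : B' ⇒ B} {j : B ⇒ B'} → j ∘ i ≡ id → j ∘ (i ∘ a) ≡ a
  cancelˡ eq = trans (pullˡ eq) identityˡ

  ∘-⊗ : ∀ {A B B' D E F} {f : B ⇒ B'} {g : A ⇒ B} {h : E ⇒ F} {k : D ⇒ E} →
        (f ⊗₁ h) ∘ (g ⊗₁ k) ≡ (f ∘ g) ⊗₁ (h ∘ k)
  ∘-⊗ = sym ⊗-∘

  ∘⊗id : ∀ {A B B' X} {a : B ⇒ B'} {b : A ⇒ B} → (a ∘ b) ⊗₁ id {X} ≡ (a ⊗₁ id) ∘ (b ⊗₁ id)
  ∘⊗id {a = a} {b} = trans (cong ((a ∘ b) ⊗₁_) (sym identityˡ)) ⊗-∘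

  ⊗-splitˡ : ∀ {A B B' D} {f : A ⇒ B} {g : B' ⇒ D} → f ⊗₁ g ≡ (f ⊗₁ id) ∘ (id ⊗₁ g)
  ⊗-splitˡ = trans (cong₂ _⊗₁_ (sym identityʳ) (sym identityˡ)) ⊗-∘

  ⊗-splitʳ : ∀ {A B B' D} {f : A ⇒ B} {g : B' ⇒ D} → f ⊗₁ g ≡ (id ⊗₁ g) ∘ (f ⊗₁ id)
  ⊗-splitʳ = trans (cong₂ _⊗₁_ (sym identityˡ) (sym identityʳ)) ⊗-∘

  ⊗-commute : ∀ {A B B' D} {f : A ⇒ B} {g : B' ⇒ D} →
              (f ⊗₁ id) ∘ (id ⊗₁ g) ≡ (id ⊗₁ g) ∘ (f ⊗₁ id)
  ⊗-commute = trans (sym ⊗-splitˡ) ⊗-splitʳ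

  invert-square : ∀ {X Y X' Y'} {i : X ⇒ Y} {j : Y ⇒ X} {F : X ⇒ X'} {G : Y ⇒ Y'}
                    {i' : X' ⇒ Y'} {j' : Y' ⇒ X'} →
                  j' ∘ i' ≡ id → i ∘ j ≡ id → i' ∘ F ≡ G ∘ i → j' ∘ G ≡ F ∘ j
  invert-square {i = i} {j} {F} {G} {i'} {j'} j'i' ij sq = begin
    j' ∘ G                 ≡⟨ cong (j' ∘_) (sym (cancelʳ ij)) ⟩
    j' ∘ ((G ∘ i) ∘ j)     ≡⟨ cong (λ t → j' ∘ (t ∘ j)) (sym sq) ⟩
    j' ∘ ((i' ∘ F) ∘ j)    ≡⟨ cong (j' ∘_) assoc ⟩
    j' ∘ (i' ∘ (F ∘ j))    ≡⟨ cancelˡ j'i' ⟩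
    F ∘ j                  ∎

  λ⇐-nat : ∀ {A B} {f : A ⇒ B} → λ⇐ ∘ f ≡ (id ⊗₁ f) ∘ λ⇐
  λ⇐-nat = invert-square λ-iso₂ λ-iso₁ λ-nat

  ρ⇐-nat : ∀ {A B} {f : A ⇒ B} → ρ⇐ ∘ f ≡ (f ⊗₁ id) ∘ ρ⇐
  ρ⇐-nat = invert-square ρ-iso₂ ρ-iso₁ ρ-nat

  α⇐-nat : ∀ {A B B' D E F} {f : A ⇒ D} {g : B ⇒ E} {h : B' ⇒ F} →
           α⇐ ∘ (f ⊗₁ (g ⊗₁ h)) ≡ ((f ⊗₁ g) ⊗₁ h) ∘ α⇐
  α⇐-nat = invert-square α-iso₂ α-iso₁ α-nat

  id⊗-injective : ∀ {A B} {f g : A ⇒ B} → id {unit} ⊗₁ f ≡ id ⊗₁ g → f ≡ g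
  id⊗-injective {f = f} {g} eq = begin
    f                     ≡⟨ sym (cancelʳ λ-iso₁) ⟩
    (f ∘ λ⇒) ∘ λ⇐         ≡⟨ cong (_∘ λ⇐) (sym λ-nat) ⟩
    (λ⇒ ∘ (id ⊗₁ f)) ∘ λ⇐ ≡⟨ cong (λ t → (λ⇒ ∘ t) ∘ λ⇐) eq ⟩
    (λ⇒ ∘ (id ⊗₁ g)) ∘ λ⇐ ≡⟨ cong (_∘ λ⇐) λ-nat ⟩
    (g ∘ λ⇒) ∘ λ⇐         ≡⟨ cancelʳ λ-iso₁ ⟩
    g                     ∎

  -- Kelly's coherence lemma: tensoring with I on the left makes it follow from pentagon and triangle.
  λ⇒∘α⇒ : ∀ {A B} → λ⇒ {A ⊗₀ B} ∘ α⇒ {unit} {A} {B} ≡ λ⇒ ⊗₁ id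
  λ⇒∘α⇒ {A} {B} = id⊗-injective (begin
      id ⊗₁ (λ⇒ ∘ α⇒)                  ≡⟨ sym (cancelʳ P∘P⁻¹) ⟩
      ((id ⊗₁ (λ⇒ ∘ α⇒)) ∘ P) ∘ P⁻¹    ≡⟨ cong (_∘ P⁻¹) square ⟩
      ((id ⊗₁ (λ⇒ ⊗₁ id)) ∘ P) ∘ P⁻¹   ≡⟨ cancelʳ P∘P⁻¹ ⟩
      id ⊗₁ (λ⇒ ⊗₁ id)                 ∎)
    where
    P : ((unit ⊗₀ unit) ⊗₀ A) ⊗₀ B ⇒ unit ⊗₀ ((unit ⊗₀ A) ⊗₀ B)
    P = α⇒ ∘ (α⇒ ⊗₁ id)
    P⁻¹ : unit ⊗₀ ((unit ⊗₀ A) ⊗₀ B) ⇒ ((unit ⊗₀ unit) ⊗₀ A) ⊗₀ B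
    P⁻¹ = (α⇐ ⊗₁ id) ∘ α⇐
    P∘P⁻¹ : P ∘ P⁻¹ ≡ id
    P∘P⁻¹ = begin
      (α⇒ ∘ (α⇒ ⊗₁ id)) ∘ ((α⇐ ⊗₁ id) ∘ α⇐) ≡⟨ trans assoc (cong (α⇒ ∘_) (pullˡ ∘-⊗)) ⟩
      α⇒ ∘ (((α⇒ ∘ α⇐) ⊗₁ (id ∘ id)) ∘ α⇐)  ≡⟨ cong (λ t → α⇒ ∘ (t ∘ α⇐)) (trans (cong₂ _⊗₁_ α-iso₁ identityˡ) ⊗-id) ⟩
      α⇒ ∘ (id ∘ α⇐)                         ≡⟨ trans (cong (α⇒ ∘_) identityˡ) α-iso₁ ⟩
      id                                     ∎
    square : (id ⊗₁ (λ⇒ ∘ α⇒)) ∘ P ≡ (id ⊗₁ (λ⇒ ⊗₁ id)) ∘ P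
    square = begin
      (id ⊗₁ (λ⇒ ∘ α⇒)) ∘ (α⇒ ∘ (α⇒ ⊗₁ id))
        ≡⟨ cong (_∘ P) (trans (cong (_⊗₁ (λ⇒ ∘ α⇒)) (sym identityˡ)) ⊗-∘) ⟩
      ((id ⊗₁ λ⇒) ∘ (id ⊗₁ α⇒)) ∘ (α⇒ ∘ (α⇒ ⊗₁ id))
        ≡⟨ trans assoc (cong ((id ⊗₁ λ⇒) ∘_) pentagon) ⟩
      (id ⊗₁ λ⇒) ∘ (α⇒ ∘ α⇒)
        ≡⟨ pullˡ triangle ⟩
      (ρ⇒ ⊗₁ id) ∘ α⇒
        ≡⟨ cong (λ t → (ρ⇒ ⊗₁ t) ∘ α⇒) (sym ⊗-id) ⟩
      (ρ⇒ ⊗₁ (id ⊗₁ id)) ∘ α⇒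
        ≡⟨ sym α-nat ⟩
      α⇒ ∘ ((ρ⇒ ⊗₁ id) ⊗₁ id)
        ≡⟨ cong (λ t → α⇒ ∘ (t ⊗₁ id)) (sym triangle) ⟩
      α⇒ ∘ (((id ⊗₁ λ⇒) ∘ α⇒) ⊗₁ id)
        ≡⟨ cong (α⇒ ∘_) ∘⊗id ⟩
      α⇒ ∘ (((id ⊗₁ λ⇒) ⊗₁ id) ∘ (α⇒ ⊗₁ id))
        ≡⟨ pullˡ α-nat ⟩
      ((id ⊗₁ (λ⇒ ⊗₁ id)) ∘ α⇒) ∘ (α⇒ ⊗₁ id)
        ≡⟨ assoc ⟩
      (id ⊗₁ (λ⇒ ⊗₁ id)) ∘ (α⇒ ∘ (α⇒ ⊗₁ id)) ∎

  α⇐∘λ⇐ : ∀ {A B} → α⇐ {unit} {A} {B} ∘ λ⇐ ≡ λ⇐ ⊗₁ id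
  α⇐∘λ⇐ = begin
    α⇐ ∘ λ⇐                                   ≡⟨ sym identityˡ ⟩
    id ∘ (α⇐ ∘ λ⇐)                            ≡⟨ cong (_∘ (α⇐ ∘ λ⇐)) (sym λ⇐⊗id∘λ⇒⊗id) ⟩
    ((λ⇐ ⊗₁ id) ∘ (λ⇒ ⊗₁ id)) ∘ (α⇐ ∘ λ⇐)     ≡⟨ cong (λ t → ((λ⇐ ⊗₁ id) ∘ t) ∘ (α⇐ ∘ λ⇐)) (sym λ⇒∘α⇒) ⟩
    ((λ⇐ ⊗₁ id) ∘ (λ⇒ ∘ α⇒)) ∘ (α⇐ ∘ λ⇐)      ≡⟨ trans assoc (cong ((λ⇐ ⊗₁ id) ∘_) (trans assoc (cong (λ⇒ ∘_) (cancelˡ α-iso₁)))) ⟩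
    (λ⇐ ⊗₁ id) ∘ (λ⇒ ∘ λ⇐)                    ≡⟨ trans (cong ((λ⇐ ⊗₁ id) ∘_) λ-iso₁) identityʳ ⟩
    λ⇐ ⊗₁ id                                  ∎
    where
    λ⇐⊗id∘λ⇒⊗id : ∀ {A B} → (λ⇐ {A} ⊗₁ id {B}) ∘ (λ⇒ ⊗₁ id) ≡ id
    λ⇐⊗id∘λ⇒⊗id = trans ∘-⊗ (trans (cong₂ _⊗₁_ λ-iso₂ identityˡ) ⊗-id)

  α⇒∘λ⇐⊗id : ∀ {A B} → α⇒ {unit} {A} {B} ∘ (λ⇐ ⊗₁ id) ≡ λ⇐
  α⇒∘λ⇐⊗id = trans (cong (α⇒ ∘_) (sym α⇐∘λ⇐)) (cancelˡ α-iso₁)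

  insertˡ : ∀ {A Z} → unit ⇒ Z → A ⇒ Z ⊗₀ A
  insertˡ z = (z ⊗₁ id) ∘ λ⇐

  insertˡ-nat : ∀ {A B Z} {z : unit ⇒ Z} {f : A ⇒ B} → (id ⊗₁ f) ∘ insertˡ z ≡ insertˡ z ∘ f
  insertˡ-nat {z = z} {f} = begin
    (id ⊗₁ f) ∘ (z ⊗₁ id) ∘ λ⇐    ≡⟨ pullˡ (sym ⊗-commute) ⟩
    ((z ⊗₁ id) ∘ (id ⊗₁ f)) ∘ λ⇐  ≡⟨ trans assoc (cong ((z ⊗₁ id) ∘_) (sym λ⇐-nat)) ⟩
    (z ⊗₁ id) ∘ λ⇐ ∘ f            ≡⟨ sym assoc ⟩
    insertˡ z ∘ f                 ∎

  α⇒∘insertˡ⊗id : ∀ {A B Z} {z : unit ⇒ Z} → α⇒ {Z} {A} {B} ∘ (insertˡ z ⊗₁ id) ≡ insertˡ z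
  α⇒∘insertˡ⊗id {z = z} = begin
    α⇒ ∘ (((z ⊗₁ id) ∘ λ⇐) ⊗₁ id)          ≡⟨ cong (α⇒ ∘_) ∘⊗id ⟩
    α⇒ ∘ ((z ⊗₁ id) ⊗₁ id) ∘ (λ⇐ ⊗₁ id)    ≡⟨ pullˡ α-nat ⟩
    ((z ⊗₁ (id ⊗₁ id)) ∘ α⇒) ∘ (λ⇐ ⊗₁ id)  ≡⟨ trans assoc (cong₂ _∘_ (cong (z ⊗₁_) ⊗-id) α⇒∘λ⇐⊗id) ⟩
    (z ⊗₁ id) ∘ λ⇐                         ∎

  α⇐∘insertˡ : ∀ {A B Z} {z : unit ⇒ Z} → α⇐ {Z} {A} {B} ∘ insertˡ z ≡ insertˡ z ⊗₁ id
  α⇐∘insertˡ = trans (cong (α⇐ ∘_) (sym α⇒∘insertˡ⊗id)) (cancelˡ α-iso₂)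

  λ⇒∘[e⊗id]∘insertˡ : ∀ {A Z} {z : unit ⇒ Z} {e : Z ⇒ unit} → e ∘ z ≡ id →
                      (λ⇒ ∘ (e ⊗₁ id)) ∘ insertˡ z ≡ id {A}
  λ⇒∘[e⊗id]∘insertˡ {z = z} {e} e∘z = begin
    (λ⇒ ∘ (e ⊗₁ id)) ∘ (z ⊗₁ id) ∘ λ⇐  ≡⟨ trans assoc (cong (λ⇒ ∘_) (pullˡ ∘-⊗)) ⟩
    λ⇒ ∘ ((e ∘ z) ⊗₁ (id ∘ id)) ∘ λ⇐   ≡⟨ cong (λ t → λ⇒ ∘ t ∘ λ⇐) (trans (cong₂ _⊗₁_ e∘z identityˡ) ⊗-id) ⟩
    λ⇒ ∘ id ∘ λ⇐                       ≡⟨ trans (cong (λ⇒ ∘_) identityˡ) λ-iso₁ ⟩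
    id                                 ∎

  -- interchange = α⇐ ∘ (id ⊗₁ middleSwap) ∘ α⇒
  middleSwap : ∀ {A B B'} → A ⊗₀ (B ⊗₀ B') ⇒ B ⊗₀ (A ⊗₀ B')
  middleSwap = α⇒ ∘ (σ ⊗₁ id) ∘ α⇐

  middleSwap-nat : ∀ {A B B' A' D D'} {g : A ⇒ A'} {h : B ⇒ D} {k : B' ⇒ D'} →
                   middleSwap ∘ (g ⊗₁ (h ⊗₁ k)) ≡ (h ⊗₁ (g ⊗₁ k)) ∘ middleSwap
  middleSwap-nat {g = g} {h} {k} = begin
    (α⇒ ∘ (σ ⊗₁ id) ∘ α⇐) ∘ (g ⊗₁ (h ⊗₁ k))   ≡⟨ trans assoc (cong (α⇒ ∘_) assoc) ⟩
    α⇒ ∘ (σ ⊗₁ id) ∘ (α⇐ ∘ (g ⊗₁ (h ⊗₁ k)))   ≡⟨ cong (λ t → α⇒ ∘ (σ ⊗₁ id) ∘ t) α⇐-nat ⟩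
    α⇒ ∘ (σ ⊗₁ id) ∘ (((g ⊗₁ h) ⊗₁ k) ∘ α⇐)   ≡⟨ cong (α⇒ ∘_) (pullˡ ∘-⊗) ⟩
    α⇒ ∘ ((σ ∘ (g ⊗₁ h)) ⊗₁ (id ∘ k)) ∘ α⇐    ≡⟨ cong (λ t → α⇒ ∘ t ∘ α⇐)
                                                   (cong₂ _⊗₁_ σ-nat (trans identityˡ (sym identityʳ))) ⟩
    α⇒ ∘ (((h ⊗₁ g) ∘ σ) ⊗₁ (k ∘ id)) ∘ α⇐    ≡⟨ cong (λ t → α⇒ ∘ t ∘ α⇐) ⊗-∘ ⟩
    α⇒ ∘ (((h ⊗₁ g) ⊗₁ k) ∘ (σ ⊗₁ id)) ∘ α⇐   ≡⟨ cong (α⇒ ∘_) assoc ⟩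
    α⇒ ∘ ((h ⊗₁ g) ⊗₁ k) ∘ ((σ ⊗₁ id) ∘ α⇐)   ≡⟨ pullˡ α-nat ⟩
    ((h ⊗₁ (g ⊗₁ k)) ∘ α⇒) ∘ ((σ ⊗₁ id) ∘ α⇐) ≡⟨ assoc ⟩
    (h ⊗₁ (g ⊗₁ k)) ∘ (α⇒ ∘ (σ ⊗₁ id) ∘ α⇐)   ∎

  interchange-nat : ∀ {A B B' D A' E B'' D'} {f : A ⇒ A'} {g : B ⇒ E} {h : B' ⇒ B''} {k : D ⇒ D'} →
    interchange ∘ ((f ⊗₁ g) ⊗₁ (h ⊗₁ k)) ≡ ((f ⊗₁ h) ⊗₁ (g ⊗₁ k)) ∘ interchange
  interchange-nat {f = f} {g} {h} {k} = begin
    (α⇐ ∘ (id ⊗₁ middleSwap) ∘ α⇒) ∘ ((f ⊗₁ g) ⊗₁ (h ⊗₁ k))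
      ≡⟨ trans assoc (cong (α⇐ ∘_) assoc) ⟩
    α⇐ ∘ (id ⊗₁ middleSwap) ∘ (α⇒ ∘ ((f ⊗₁ g) ⊗₁ (h ⊗₁ k)))
      ≡⟨ cong (λ t → α⇐ ∘ (id ⊗₁ middleSwap) ∘ t) α-nat ⟩
    α⇐ ∘ (id ⊗₁ middleSwap) ∘ ((f ⊗₁ (g ⊗₁ (h ⊗₁ k))) ∘ α⇒)
      ≡⟨ cong (α⇐ ∘_) (pullˡ ∘-⊗) ⟩
    α⇐ ∘ ((id ∘ f) ⊗₁ (middleSwap ∘ (g ⊗₁ (h ⊗₁ k)))) ∘ α⇒
      ≡⟨ cong (λ t → α⇐ ∘ t ∘ α⇒) (cong₂ _⊗₁_ (trans identityˡ (sym identityʳ)) middleSwap-nat) ⟩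
    α⇐ ∘ ((f ∘ id) ⊗₁ ((h ⊗₁ (g ⊗₁ k)) ∘ middleSwap)) ∘ α⇒
      ≡⟨ cong (λ t → α⇐ ∘ t ∘ α⇒) ⊗-∘ ⟩
    α⇐ ∘ ((f ⊗₁ (h ⊗₁ (g ⊗₁ k))) ∘ (id ⊗₁ middleSwap)) ∘ α⇒
      ≡⟨ cong (α⇐ ∘_) assoc ⟩
    α⇐ ∘ (f ⊗₁ (h ⊗₁ (g ⊗₁ k))) ∘ ((id ⊗₁ middleSwap) ∘ α⇒)
      ≡⟨ pullˡ α⇐-nat ⟩
    (((f ⊗₁ h) ⊗₁ (g ⊗₁ k)) ∘ α⇐) ∘ ((id ⊗₁ middleSwap) ∘ α⇒)
      ≡⟨ assoc ⟩
    ((f ⊗₁ h) ⊗₁ (g ⊗₁ k)) ∘ (α⇐ ∘ (id ⊗₁ middleSwap) ∘ α⇒) ∎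

module CopyDiscard {o ℓ} (C : SymMonCat o ℓ) (D : IsCD C) where
  open SymMonCat C
  open IsCD D
  open Monoidal C
  open ≡-Reasoning

  λ⇐∘-via-Δ : ∀ {A B} {k : A ⇒ B} → λ⇐ ∘ k ≡ (ε ⊗₁ k) ∘ Δ
  λ⇐∘-via-Δ {k = k} = begin
    λ⇐ ∘ k                      ≡⟨ λ⇐-nat ⟩
    (id ⊗₁ k) ∘ λ⇐              ≡⟨ cong ((id ⊗₁ k) ∘_) (sym counitˡ) ⟩
    (id ⊗₁ k) ∘ ((ε ⊗₁ id) ∘ Δ) ≡⟨ pullˡ (trans ∘-⊗ (cong₂ _⊗₁_ identityˡ identityʳ)) ⟩
    (ε ⊗₁ k) ∘ Δ                ∎

  ρ⇐∘-via-Δ : ∀ {A B} {k : A ⇒ B} → ρ⇐ ∘ k ≡ (k ⊗₁ ε) ∘ Δ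
  ρ⇐∘-via-Δ {k = k} = begin
    ρ⇐ ∘ k                      ≡⟨ ρ⇐-nat ⟩
    (k ⊗₁ id) ∘ ρ⇐              ≡⟨ cong ((k ⊗₁ id) ∘_) (sym counitʳ) ⟩
    (k ⊗₁ id) ∘ ((id ⊗₁ ε) ∘ Δ) ≡⟨ pullˡ (trans ∘-⊗ (cong₂ _⊗₁_ identityʳ identityˡ)) ⟩
    (k ⊗₁ ε) ∘ Δ                ∎

  ρ⇒-unit : ρ⇒ {unit} ≡ λ⇒
  ρ⇒-unit = begin
    ρ⇒                 ≡⟨ sym (cancelʳ λ-iso₂) ⟩
    (ρ⇒ ∘ λ⇐) ∘ λ⇒     ≡⟨ cong (λ t → (ρ⇒ ∘ t) ∘ λ⇒) (trans (sym Δ-unit) (sym ρ⇐-unit)) ⟩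
    (ρ⇒ ∘ ρ⇐) ∘ λ⇒     ≡⟨ trans (cong (_∘ λ⇒) ρ-iso₁) identityˡ ⟩
    λ⇒                 ∎
    where
    ρ⇐-unit : ρ⇐ {unit} ≡ Δ
    ρ⇐-unit = begin
      ρ⇐                ≡⟨ sym counitʳ ⟩
      (id ⊗₁ ε) ∘ Δ     ≡⟨ cong (λ t → (id ⊗₁ t) ∘ Δ) ε-unit ⟩
      (id ⊗₁ id) ∘ Δ    ≡⟨ trans (cong (_∘ Δ) ⊗-id) identityˡ ⟩
      Δ                 ∎

  IsChannel-∘ : ∀ {A B B'} {f : B ⇒ B'} {g : A ⇒ B} → IsChannel f → IsChannel g → IsChannel (f ∘ g)
  IsChannel-∘ cf cg = trans (pullˡ cf) cg

  IsChannel-⊗ : ∀ {A B B' D} {f : A ⇒ B} {g : B' ⇒ D} → IsChannel f → IsChannel g → IsChannel (f ⊗₁ g)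
  IsChannel-⊗ {f = f} {g} cf cg = begin
    ε ∘ (f ⊗₁ g)               ≡⟨ cong (_∘ (f ⊗₁ g)) ε-⊗ ⟩
    (λ⇒ ∘ (ε ⊗₁ ε)) ∘ (f ⊗₁ g) ≡⟨ trans assoc (cong (λ⇒ ∘_) (trans ∘-⊗ (cong₂ _⊗₁_ cf cg))) ⟩
    λ⇒ ∘ (ε ⊗₁ ε)              ≡⟨ sym ε-⊗ ⟩
    ε                          ∎

  IsChannel-id : ∀ {A} → IsChannel (id {A})
  IsChannel-id = identityʳ

  IsChannel-ε : ∀ {A} → IsChannel (ε {A})
  IsChannel-ε = trans (cong (_∘ ε) ε-unit) identityˡ

  IsChannel-ρ⇒ : ∀ {A} → IsChannel (ρ⇒ {A})
  IsChannel-ρ⇒ = begin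
    ε ∘ ρ⇒                ≡⟨ sym ρ-nat ⟩
    ρ⇒ ∘ (ε ⊗₁ id)        ≡⟨ cong₂ (λ a b → a ∘ (ε ⊗₁ b)) ρ⇒-unit (sym ε-unit) ⟩
    λ⇒ ∘ (ε ⊗₁ ε)         ≡⟨ sym ε-⊗ ⟩
    ε                     ∎

  Deterministic : ∀ {A B} → A ⇒ B → Set ℓ
  Deterministic f = Δ ∘ f ≡ (f ⊗₁ f) ∘ Δ

  Deterministic-id : ∀ {A} → Deterministic (id {A})
  Deterministic-id = trans identityʳ (trans (sym identityˡ) (cong (_∘ Δ) (sym ⊗-id)))

  Deterministic-∘ : ∀ {A B B'} {f : B ⇒ B'} {g : A ⇒ B} →
                    Deterministic f → Deterministic g → Deterministic (f ∘ g)
  Deterministic-∘ {f = f} {g} df dg = begin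
    Δ ∘ (f ∘ g)               ≡⟨ pullˡ df ⟩
    ((f ⊗₁ f) ∘ Δ) ∘ g        ≡⟨ trans assoc (cong ((f ⊗₁ f) ∘_) dg) ⟩
    (f ⊗₁ f) ∘ ((g ⊗₁ g) ∘ Δ) ≡⟨ pullˡ ∘-⊗ ⟩
    ((f ∘ g) ⊗₁ (f ∘ g)) ∘ Δ  ∎

  Deterministic-⊗ : ∀ {A B B' D} {f : A ⇒ B} {g : B' ⇒ D} →
                    Deterministic f → Deterministic g → Deterministic (f ⊗₁ g)
  Deterministic-⊗ {f = f} {g} df dg = begin
    Δ ∘ (f ⊗₁ g)                                      ≡⟨ cong (_∘ (f ⊗₁ g)) Δ-⊗ ⟩
    (interchange ∘ (Δ ⊗₁ Δ)) ∘ (f ⊗₁ g)               ≡⟨ trans assoc (cong (interchange ∘_) ∘-⊗) ⟩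
    interchange ∘ ((Δ ∘ f) ⊗₁ (Δ ∘ g))                ≡⟨ cong (interchange ∘_) (trans (cong₂ _⊗₁_ df dg) ⊗-∘) ⟩
    interchange ∘ (((f ⊗₁ f) ⊗₁ (g ⊗₁ g)) ∘ (Δ ⊗₁ Δ)) ≡⟨ pullˡ interchange-nat ⟩
    (((f ⊗₁ g) ⊗₁ (f ⊗₁ g)) ∘ interchange) ∘ (Δ ⊗₁ Δ) ≡⟨ trans assoc (cong (((f ⊗₁ g) ⊗₁ (f ⊗₁ g)) ∘_) (sym Δ-⊗)) ⟩
    ((f ⊗₁ g) ⊗₁ (f ⊗₁ g)) ∘ Δ                        ∎

  Deterministic-ε : ∀ {A} → Deterministic (ε {A})
  Deterministic-ε = trans (cong (_∘ ε) Δ-unit) λ⇐∘-via-Δ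

  -- Expanding Δ_{A ⊗ A} by Δ-⊗, this reduces to coassociativity and cocommutativity.
  Deterministic-Δ : ∀ {A} → Deterministic (Δ {A})
  Deterministic-Δ = begin
    Δ ∘ Δ                                                 ≡⟨ cong (_∘ Δ) Δ-⊗ ⟩
    (interchange ∘ (Δ ⊗₁ Δ)) ∘ Δ                          ≡⟨ trans assoc (trans assoc (cong (α⇐ ∘_) assoc)) ⟩
    α⇐ ∘ (id ⊗₁ middleSwap) ∘ (α⇒ ∘ ((Δ ⊗₁ Δ) ∘ Δ))       ≡⟨ cong (λ t → α⇐ ∘ (id ⊗₁ middleSwap) ∘ t) reassociate ⟩
    α⇐ ∘ (id ⊗₁ middleSwap) ∘ ((id ⊗₁ Δ₃) ∘ Δ)           ≡⟨ cong (α⇐ ∘_) (pullˡ ∘-⊗) ⟩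
    α⇐ ∘ ((id ∘ id) ⊗₁ (middleSwap ∘ Δ₃)) ∘ Δ            ≡⟨ cong (λ t → α⇐ ∘ t ∘ Δ) (cong₂ _⊗₁_ identityˡ middleSwap∘Δ₃) ⟩
    α⇐ ∘ (id ⊗₁ Δ₃) ∘ Δ                                   ≡⟨ cong (α⇐ ∘_) (sym reassociate) ⟩
    α⇐ ∘ (α⇒ ∘ ((Δ ⊗₁ Δ) ∘ Δ))                            ≡⟨ cancelˡ α-iso₂ ⟩
    (Δ ⊗₁ Δ) ∘ Δ                                          ∎
    where
    Δ₃ : ∀ {A} → A ⇒ A ⊗₀ (A ⊗₀ A)
    Δ₃ = (id ⊗₁ Δ) ∘ Δ
    reassociate : ∀ {A} → α⇒ ∘ ((Δ ⊗₁ Δ) ∘ Δ) ≡ (id ⊗₁ Δ₃) ∘ Δ {A}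
    reassociate = begin
      α⇒ ∘ ((Δ ⊗₁ Δ) ∘ Δ)
        ≡⟨ cong (λ t → α⇒ ∘ (t ∘ Δ)) (trans ⊗-splitʳ (cong (λ t → (t ⊗₁ Δ) ∘ (Δ ⊗₁ id)) (sym ⊗-id))) ⟩
      α⇒ ∘ ((((id ⊗₁ id) ⊗₁ Δ) ∘ (Δ ⊗₁ id)) ∘ Δ)  ≡⟨ cong (α⇒ ∘_) assoc ⟩
      α⇒ ∘ ((id ⊗₁ id) ⊗₁ Δ) ∘ ((Δ ⊗₁ id) ∘ Δ)    ≡⟨ pullˡ α-nat ⟩
      ((id ⊗₁ (id ⊗₁ Δ)) ∘ α⇒) ∘ ((Δ ⊗₁ id) ∘ Δ)  ≡⟨ trans assoc (cong ((id ⊗₁ (id ⊗₁ Δ)) ∘_) coassoc) ⟩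
      (id ⊗₁ (id ⊗₁ Δ)) ∘ ((id ⊗₁ Δ) ∘ Δ)         ≡⟨ pullˡ ∘-⊗ ⟩
      ((id ∘ id) ⊗₁ Δ₃) ∘ Δ                       ≡⟨ cong (λ t → (t ⊗₁ Δ₃) ∘ Δ) identityˡ ⟩
      (id ⊗₁ Δ₃) ∘ Δ                              ∎
    middleSwap∘Δ₃ : ∀ {A} → middleSwap ∘ Δ₃ ≡ Δ₃ {A}
    middleSwap∘Δ₃ = begin
      (α⇒ ∘ (σ ⊗₁ id) ∘ α⇐) ∘ ((id ⊗₁ Δ) ∘ Δ)   ≡⟨ trans assoc (cong (α⇒ ∘_) assoc) ⟩
      α⇒ ∘ (σ ⊗₁ id) ∘ (α⇐ ∘ ((id ⊗₁ Δ) ∘ Δ))   ≡⟨ cong (λ t → α⇒ ∘ (σ ⊗₁ id) ∘ t) (trans (cong (α⇐ ∘_) (sym coassoc)) (cancelˡ α-iso₂)) ⟩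
      α⇒ ∘ (σ ⊗₁ id) ∘ ((Δ ⊗₁ id) ∘ Δ)          ≡⟨ cong (α⇒ ∘_) (pullˡ ∘-⊗) ⟩
      α⇒ ∘ ((σ ∘ Δ) ⊗₁ (id ∘ id)) ∘ Δ           ≡⟨ cong (λ t → α⇒ ∘ t ∘ Δ) (cong₂ _⊗₁_ cocomm identityˡ) ⟩
      α⇒ ∘ (Δ ⊗₁ id) ∘ Δ                        ≡⟨ coassoc ⟩
      (id ⊗₁ Δ) ∘ Δ                             ∎

  Deterministic-ρ⇒ : ∀ {A} → Deterministic (ρ⇒ {A})
  Deterministic-ρ⇒ = begin
    Δ ∘ ρ⇒                                ≡⟨ sym identityˡ ⟩
    id ∘ (Δ ∘ ρ⇒)                         ≡⟨ cong (_∘ (Δ ∘ ρ⇒)) (sym ρ⇒⊗ρ⇒∘ρ⇐⊗ρ⇐) ⟩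
    ((ρ⇒ ⊗₁ ρ⇒) ∘ (ρ⇐ ⊗₁ ρ⇐)) ∘ (Δ ∘ ρ⇒)  ≡⟨ trans assoc (cong ((ρ⇒ ⊗₁ ρ⇒) ∘_) (pullˡ (sym Deterministic-ρ⇐))) ⟩
    (ρ⇒ ⊗₁ ρ⇒) ∘ ((Δ ∘ ρ⇐) ∘ ρ⇒)          ≡⟨ cong ((ρ⇒ ⊗₁ ρ⇒) ∘_) (trans assoc (trans (cong (Δ ∘_) ρ-iso₂) identityʳ)) ⟩
    (ρ⇒ ⊗₁ ρ⇒) ∘ Δ                        ∎
    where
    Deterministic-ρ⇐ : ∀ {A} → Deterministic (ρ⇐ {A})
    Deterministic-ρ⇐ = subst Deterministic counitʳ
      (Deterministic-∘ (Deterministic-⊗ Deterministic-id Deterministic-ε) Deterministic-Δ)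
    ρ⇒⊗ρ⇒∘ρ⇐⊗ρ⇐ : ∀ {A} → (ρ⇒ {A} ⊗₁ ρ⇒ {A}) ∘ (ρ⇐ ⊗₁ ρ⇐) ≡ id
    ρ⇒⊗ρ⇒∘ρ⇐⊗ρ⇐ = trans ∘-⊗ (trans (cong₂ _⊗₁_ ρ-iso₁ ρ-iso₁) ⊗-id)

  σ∘graph : ∀ {A B} {c : A ⇒ B} → σ ∘ (id ⊗₁ c) ∘ Δ ≡ (c ⊗₁ id) ∘ Δ
  σ∘graph {c = c} = begin
    σ ∘ (id ⊗₁ c) ∘ Δ      ≡⟨ pullˡ σ-nat ⟩
    ((c ⊗₁ id) ∘ σ) ∘ Δ    ≡⟨ trans assoc (cong ((c ⊗₁ id) ∘_) cocomm) ⟩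
    (c ⊗₁ id) ∘ Δ          ∎

  Deterministic⇒graph : ∀ {A B W} {m : W ⇒ A} {c : A ⇒ B} → Deterministic m →
                        (m ⊗₁ id) ∘ (id ⊗₁ (c ∘ m)) ∘ Δ ≡ (id ⊗₁ c) ∘ Δ ∘ m
  Deterministic⇒graph {m = m} {c} dm = begin
    (m ⊗₁ id) ∘ (id ⊗₁ (c ∘ m)) ∘ Δ      ≡⟨ pullˡ ∘-⊗ ⟩
    ((m ∘ id) ⊗₁ (id ∘ (c ∘ m))) ∘ Δ     ≡⟨ cong (_∘ Δ) (trans (cong₂ _⊗₁_ (trans identityʳ (sym identityˡ)) identityˡ) ⊗-∘) ⟩
    ((id ⊗₁ c) ∘ (m ⊗₁ m)) ∘ Δ           ≡⟨ trans assoc (cong ((id ⊗₁ c) ∘_) (sym dm)) ⟩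
    (id ⊗₁ c) ∘ Δ ∘ m                    ∎

  marginal-of-extension : ∀ {W A B Y} {f : W ⇒ A} {k : W ⇒ B} {J : Y ⇒ W} → IsChannel k →
                          (ρ⇒ ∘ (f ⊗₁ ε)) ∘ (id ⊗₁ k) ∘ Δ ∘ J ≡ f ∘ J
  marginal-of-extension {f = f} {k} {J} ck = begin
    (ρ⇒ ∘ (f ⊗₁ ε)) ∘ (id ⊗₁ k) ∘ Δ ∘ J     ≡⟨ trans assoc (cong (ρ⇒ ∘_) (pullˡ ∘-⊗)) ⟩
    ρ⇒ ∘ ((f ∘ id) ⊗₁ (ε ∘ k)) ∘ Δ ∘ J      ≡⟨ cong (λ t → ρ⇒ ∘ t ∘ Δ ∘ J) (cong₂ _⊗₁_ identityʳ ck) ⟩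
    ρ⇒ ∘ (f ⊗₁ ε) ∘ Δ ∘ J                   ≡⟨ cong (ρ⇒ ∘_) (pullˡ (sym ρ⇐∘-via-Δ)) ⟩
    ρ⇒ ∘ (ρ⇐ ∘ f) ∘ J                       ≡⟨ trans (cong (ρ⇒ ∘_) assoc) (cancelˡ ρ-iso₁) ⟩
    f ∘ J                                   ∎

module Conditionals {o ℓ} (C : SymMonCat o ℓ) (D : IsCD C) (E : EffectConditioning C D) where
  open SymMonCat C
  open IsCD D
  open EffectConditioning E
  open Monoidal C
  open CopyDiscard C D
  open ≡-Reasoning

  norm-copy : ∀ {A B B'} {k : A ⇒ B} {l : A ⇒ B'} → norm ((k ⊗₁ l) ∘ Δ) ≡ (norm k ⊗₁ norm l) ∘ Δ
  norm-copy {k = k} {l} = trans (norm-Δ (k ⊗₁ l)) (cong (_∘ Δ) (norm-⊗ k l))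

  norm-channel : ∀ {A B} {f : A ⇒ B} → IsChannel f → norm f ≡ f
  norm-channel {f = f} cf = norm-fix f (sym (begin
    ρ⇒ ∘ (f ⊗₁ (ε ∘ f)) ∘ Δ ≡⟨ cong (λ t → ρ⇒ ∘ (f ⊗₁ t) ∘ Δ) cf ⟩
    ρ⇒ ∘ (f ⊗₁ ε) ∘ Δ       ≡⟨ cong (ρ⇒ ∘_) (sym ρ⇐∘-via-Δ) ⟩
    ρ⇒ ∘ (ρ⇐ ∘ f)           ≡⟨ cancelˡ ρ-iso₁ ⟩
    f                       ∎))

  norm-λ⇒∘ : ∀ {A B} {k : A ⇒ unit ⊗₀ B} → norm (λ⇒ ∘ k) ≡ λ⇒ ∘ norm k
  norm-λ⇒∘ {k = k} = sym (begin
    λ⇒ ∘ norm k                          ≡⟨ cong (λ t → λ⇒ ∘ norm t) (sym (cancelˡ λ-iso₂)) ⟩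
    λ⇒ ∘ norm (λ⇐ ∘ (λ⇒ ∘ k))            ≡⟨ cong (λ t → λ⇒ ∘ norm t) λ⇐∘-via-Δ ⟩
    λ⇒ ∘ norm ((ε ⊗₁ (λ⇒ ∘ k)) ∘ Δ)      ≡⟨ cong (λ⇒ ∘_) norm-copy ⟩
    λ⇒ ∘ ((norm ε ⊗₁ norm (λ⇒ ∘ k)) ∘ Δ) ≡⟨ cong (λ t → λ⇒ ∘ ((t ⊗₁ norm (λ⇒ ∘ k)) ∘ Δ)) (norm-channel IsChannel-ε) ⟩
    λ⇒ ∘ ((ε ⊗₁ norm (λ⇒ ∘ k)) ∘ Δ)      ≡⟨ cong (λ⇒ ∘_) (sym λ⇐∘-via-Δ) ⟩
    λ⇒ ∘ (λ⇐ ∘ norm (λ⇒ ∘ k))            ≡⟨ cancelˡ λ-iso₁ ⟩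
    norm (λ⇒ ∘ k)                        ∎)

  norm-insertˡ : ∀ {A B Z} {z : unit ⇒ Z} {h : A ⇒ B} → ε ∘ z ≡ id →
                 norm (insertˡ z ∘ h) ≡ insertˡ z ∘ norm h
  norm-insertˡ {z = z} {h} εz = begin
    norm (insertˡ z ∘ h)              ≡⟨ cong norm insertˡ-via-Δ ⟩
    norm (((z ∘ ε) ⊗₁ h) ∘ Δ)         ≡⟨ norm-copy ⟩
    (norm (z ∘ ε) ⊗₁ norm h) ∘ Δ      ≡⟨ cong (λ t → (t ⊗₁ norm h) ∘ Δ) (norm-channel z∘ε-channel) ⟩
    ((z ∘ ε) ⊗₁ norm h) ∘ Δ           ≡⟨ sym insertˡ-via-Δ ⟩
    insertˡ z ∘ norm h                ∎
    where
    insertˡ-via-Δ : ∀ {A B} {k : A ⇒ B} → insertˡ z ∘ k ≡ ((z ∘ ε) ⊗₁ k) ∘ Δ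
    insertˡ-via-Δ = trans assoc (trans (cong ((z ⊗₁ id) ∘_) λ⇐∘-via-Δ)
                      (pullˡ (trans ∘-⊗ (cong ((z ∘ ε) ⊗₁_) identityˡ))))
    z∘ε-channel : ∀ {A} → IsChannel (z ∘ ε {A})
    z∘ε-channel = trans (pullˡ εz) identityˡ

  -- In the paper's notation ω_{S|T} = norm (capped ω_{S∪T}).
  capped : ∀ {A B} → unit ⇒ B ⊗₀ A → A ⇒ B
  capped s = ρ⇒ ∘ (id ⊗₁ cap) ∘ α⇒ ∘ (s ⊗₁ id) ∘ λ⇐

  HasFullSupport : ∀ {A} → unit ⇒ A → Set ℓ
  HasFullSupport q = norm (cap ∘ (q ⊗₁ id) ∘ λ⇐) ≡ ε

  capped-natural : ∀ {A B B'} {k : B ⇒ B'} {s : unit ⇒ B ⊗₀ A} →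
                   capped ((k ⊗₁ id) ∘ s) ≡ k ∘ capped s
  capped-natural {k = k} {s} = begin
    ρ⇒ ∘ (id ⊗₁ cap) ∘ α⇒ ∘ (((k ⊗₁ id) ∘ s) ⊗₁ id) ∘ λ⇐
      ≡⟨ cong (λ z → ρ⇒ ∘ (id ⊗₁ cap) ∘ α⇒ ∘ z ∘ λ⇐) ∘⊗id ⟩
    ρ⇒ ∘ (id ⊗₁ cap) ∘ α⇒ ∘ (((k ⊗₁ id) ⊗₁ id) ∘ (s ⊗₁ id)) ∘ λ⇐
      ≡⟨ cong (λ z → ρ⇒ ∘ (id ⊗₁ cap) ∘ z) (trans (cong (α⇒ ∘_) assoc) (pullˡ α-nat)) ⟩
    ρ⇒ ∘ (id ⊗₁ cap) ∘ ((k ⊗₁ (id ⊗₁ id)) ∘ α⇒) ∘ ((s ⊗₁ id) ∘ λ⇐)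
      ≡⟨ cong (λ z → ρ⇒ ∘ (id ⊗₁ cap) ∘ ((k ⊗₁ z) ∘ α⇒) ∘ ((s ⊗₁ id) ∘ λ⇐)) ⊗-id ⟩
    ρ⇒ ∘ (id ⊗₁ cap) ∘ ((k ⊗₁ id) ∘ α⇒) ∘ ((s ⊗₁ id) ∘ λ⇐)
      ≡⟨ cong (ρ⇒ ∘_) (trans (cong ((id ⊗₁ cap) ∘_) assoc) (pullˡ (sym ⊗-commute))) ⟩
    ρ⇒ ∘ ((k ⊗₁ id) ∘ (id ⊗₁ cap)) ∘ (α⇒ ∘ ((s ⊗₁ id) ∘ λ⇐))
      ≡⟨ trans (cong (ρ⇒ ∘_) assoc) (pullˡ ρ-nat) ⟩
    (k ∘ ρ⇒) ∘ ((id ⊗₁ cap) ∘ (α⇒ ∘ ((s ⊗₁ id) ∘ λ⇐)))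
      ≡⟨ assoc ⟩
    k ∘ (ρ⇒ ∘ (id ⊗₁ cap) ∘ α⇒ ∘ (s ⊗₁ id) ∘ λ⇐) ∎

  -- cap-frobenius, moved past the state q.
  capped-copy : ∀ {A} {q : unit ⇒ A} →
                capped (Δ ∘ q) ≡ λ⇒ ∘ ((cap ∘ (q ⊗₁ id) ∘ λ⇐) ⊗₁ id) ∘ Δ
  capped-copy {q = q} = begin
    ρ⇒ ∘ (id ⊗₁ cap) ∘ α⇒ ∘ ((Δ ∘ q) ⊗₁ id) ∘ λ⇐
      ≡⟨ cong (λ z → ρ⇒ ∘ (id ⊗₁ cap) ∘ α⇒ ∘ z) (trans (cong (_∘ λ⇐) ∘⊗id) assoc) ⟩
    ρ⇒ ∘ (id ⊗₁ cap) ∘ α⇒ ∘ (Δ ⊗₁ id) ∘ ((q ⊗₁ id) ∘ λ⇐)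
      ≡⟨ trans (cong (λ z → ρ⇒ ∘ (id ⊗₁ cap) ∘ z) (sym assoc))
          (trans (cong (ρ⇒ ∘_) (sym assoc)) (sym assoc)) ⟩
    (ρ⇒ ∘ (id ⊗₁ cap) ∘ α⇒ ∘ (Δ ⊗₁ id)) ∘ ((q ⊗₁ id) ∘ λ⇐)
      ≡⟨ cong (_∘ ((q ⊗₁ id) ∘ λ⇐)) (sym cap-frobenius) ⟩
    (λ⇒ ∘ (cap ⊗₁ id) ∘ α⇐ ∘ (id ⊗₁ Δ)) ∘ ((q ⊗₁ id) ∘ λ⇐)
      ≡⟨ trans assoc (cong (λ⇒ ∘_) (trans assoc (cong ((cap ⊗₁ id) ∘_) (trans assoc (cong (α⇐ ∘_) (sym assoc)))))) ⟩
    λ⇒ ∘ (cap ⊗₁ id) ∘ α⇐ ∘ ((id ⊗₁ Δ) ∘ (q ⊗₁ id)) ∘ λ⇐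
      ≡⟨ cong (λ z → λ⇒ ∘ (cap ⊗₁ id) ∘ α⇐ ∘ z ∘ λ⇐) (sym ⊗-commute) ⟩
    λ⇒ ∘ (cap ⊗₁ id) ∘ α⇐ ∘ ((q ⊗₁ id) ∘ (id ⊗₁ Δ)) ∘ λ⇐
      ≡⟨ cong (λ z → λ⇒ ∘ (cap ⊗₁ id) ∘ α⇐ ∘ z) (trans assoc (cong ((q ⊗₁ id) ∘_) (sym λ⇐-nat))) ⟩
    λ⇒ ∘ (cap ⊗₁ id) ∘ α⇐ ∘ (q ⊗₁ id) ∘ (λ⇐ ∘ Δ)
      ≡⟨ cong (λ z → λ⇒ ∘ (cap ⊗₁ id) ∘ α⇐ ∘ (q ⊗₁ z) ∘ (λ⇐ ∘ Δ)) (sym ⊗-id) ⟩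
    λ⇒ ∘ (cap ⊗₁ id) ∘ α⇐ ∘ (q ⊗₁ (id ⊗₁ id)) ∘ (λ⇐ ∘ Δ)
      ≡⟨ cong (λ z → λ⇒ ∘ (cap ⊗₁ id) ∘ z) (pullˡ α⇐-nat) ⟩
    λ⇒ ∘ (cap ⊗₁ id) ∘ (((q ⊗₁ id) ⊗₁ id) ∘ α⇐) ∘ (λ⇐ ∘ Δ)
      ≡⟨ cong (λ z → λ⇒ ∘ (cap ⊗₁ id) ∘ z)
           (trans assoc (cong (((q ⊗₁ id) ⊗₁ id) ∘_) (trans (sym assoc) (cong (_∘ Δ) α⇐∘λ⇐)))) ⟩
    λ⇒ ∘ (cap ⊗₁ id) ∘ ((q ⊗₁ id) ⊗₁ id) ∘ ((λ⇐ ⊗₁ id) ∘ Δ)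
      ≡⟨ cong (λ⇒ ∘_) (trans (pullˡ (sym ∘⊗id)) (pullˡ (sym ∘⊗id))) ⟩
    λ⇒ ∘ (((cap ∘ (q ⊗₁ id)) ∘ λ⇐) ⊗₁ id) ∘ Δ
      ≡⟨ cong (λ z → λ⇒ ∘ (z ⊗₁ id) ∘ Δ) assoc ⟩
    λ⇒ ∘ ((cap ∘ (q ⊗₁ id) ∘ λ⇐) ⊗₁ id) ∘ Δ ∎

  norm-capped-graph : ∀ {A B} {q : unit ⇒ A} {c : A ⇒ B} → HasFullSupport q → IsChannel c →
                      norm (capped ((c ⊗₁ id) ∘ Δ ∘ q)) ≡ c
  norm-capped-graph {A} {q = q} {c} full ch = begin
    norm (capped ((c ⊗₁ id) ∘ Δ ∘ q))    ≡⟨ cong norm (trans capped-natural (cong (c ∘_) capped-copy)) ⟩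
    norm (c ∘ λ⇒ ∘ (w ⊗₁ id) ∘ Δ)        ≡⟨ cong norm (trans (pullˡ (sym λ-nat)) (trans assoc (cong (λ⇒ ∘_) (pullˡ weight⊗c)))) ⟩
    norm (λ⇒ ∘ (w ⊗₁ c) ∘ Δ)             ≡⟨ trans norm-λ⇒∘ (cong (λ⇒ ∘_) norm-copy) ⟩
    λ⇒ ∘ (norm w ⊗₁ norm c) ∘ Δ          ≡⟨ cong (λ t → λ⇒ ∘ t ∘ Δ) (cong₂ _⊗₁_ full (norm-channel ch)) ⟩
    λ⇒ ∘ (ε ⊗₁ c) ∘ Δ                    ≡⟨ cong (λ⇒ ∘_) (sym λ⇐∘-via-Δ) ⟩
    λ⇒ ∘ λ⇐ ∘ c                          ≡⟨ cancelˡ λ-iso₁ ⟩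
    c                                    ∎
    where
    w : A ⇒ unit
    w = cap ∘ (q ⊗₁ id) ∘ λ⇐
    weight⊗c : (id ⊗₁ c) ∘ (w ⊗₁ id) ≡ w ⊗₁ c
    weight⊗c = trans ∘-⊗ (cong₂ _⊗₁_ identityˡ identityʳ)

module MechanismsAsConditionals {o ℓ} (C : SymMonCat o ℓ) (D : IsCD C) (E : EffectConditioning C D) where
  open SymMonCat C
  open IsCD D
  open EffectConditioning E
  open Monoidal C
  open CopyDiscard C D
  open Conditionals C D E
  open Causal C D
  open ≡-Reasoning

  emptyState : ∀ {n} (ob : Fin n → Obj) → unit ⇒ X[ (λ _ → false) ] ob
  emptyState {zero}  ob = id
  emptyState {suc n} ob = emptyState (λ i → ob (suc i))

  ε∘emptyState : ∀ {n} (ob : Fin n → Obj) → ε ∘ emptyState ob ≡ id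
  ε∘emptyState {zero}  ob = trans identityʳ ε-unit
  ε∘emptyState {suc n} ob = ε∘emptyState (λ i → ob (suc i))

  empty⇒unit≡ε : ∀ {n} (ob : Fin n → Obj) → empty⇒unit ob ≡ ε
  empty⇒unit≡ε {zero}  ob = sym ε-unit
  empty⇒unit≡ε {suc n} ob = empty⇒unit≡ε (λ i → ob (suc i))

  split-∅ : ∀ {n} {ob : Fin n → Obj} (T : Fin n → Bool) (d : Disjoint (λ _ → false) T) →
            split (λ _ → false) T d ≡ insertˡ (emptyState ob)
  split-∅ {zero}  T d = sym (trans (cong (_∘ λ⇐) ⊗-id) identityˡ)
  split-∅ {suc n} T d = splitStep-∅ (T zero) (d zero) (split-∅ (λ i → T (suc i)) (λ i → d (suc i)))
    where
    splitStep-∅ : ∀ {A X Z} {z : unit ⇒ Z} {f : A ⇒ Z ⊗₀ A} (t : Bool) (d : false ≡ true → t ≡ true → ⊥) →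
                  f ≡ insertˡ z → splitStep {X = X} false t d f ≡ insertˡ z
    splitStep-∅ false d eq = eq
    splitStep-∅ true  d refl = α⇒∘insertˡ⊗id

  splitStep-insertˡ : ∀ {A X Z} {z : unit ⇒ Z} (d : true ≡ true → false ≡ true → ⊥) →
                      splitStep {X = X} true false d (insertˡ {A} z) ≡ (insertˡ z ⊗₁ id) ∘ σ
  splitStep-insertˡ {z = z} d = begin
    α⇐ ∘ (id ⊗₁ σ) ∘ α⇒ ∘ (insertˡ z ⊗₁ id)   ≡⟨ cong (λ t → α⇐ ∘ (id ⊗₁ σ) ∘ t) α⇒∘insertˡ⊗id ⟩
    α⇐ ∘ (id ⊗₁ σ) ∘ insertˡ z                ≡⟨ cong (α⇐ ∘_) insertˡ-nat ⟩
    α⇐ ∘ insertˡ z ∘ σ                        ≡⟨ pullˡ α⇐∘insertˡ ⟩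
    (insertˡ z ⊗₁ id) ∘ σ                     ∎

  marg-∘ : ∀ {n} {ob : Fin n → Obj} (S T U : Fin n → Bool) p q r →
           marg {ob = ob} S T p ∘ marg T U q ≡ marg S U r
  marg-∘ {zero}  S T U p q r = identityˡ
  marg-∘ {suc n} S T U p q r =
    trans (margStep-∘ (S zero) (T zero) (U zero) (p zero) (q zero) (r zero))
          (cong (margStep (S zero) (U zero) (r zero))
                (marg-∘ (λ i → S (suc i)) (λ i → T (suc i)) (λ i → U (suc i))
                        (λ i → p (suc i)) (λ i → q (suc i)) (λ i → r (suc i))))
    where
    margStep-∘ : ∀ {A B B' X} {f : B ⇒ B'} {g : A ⇒ B} (s t u : Bool) pst ptu psu →
                 margStep {X = X} s t pst f ∘ margStep t u ptu g ≡ margStep s u psu (f ∘ g)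
    margStep-∘ true  true  true  _ _ _ = trans ∘-⊗ (cong (_ ⊗₁_) identityˡ)
    margStep-∘ true  true  false _ ptu _ with () ← ptu refl
    margStep-∘ true  false _     pst _ _ with () ← pst refl
    margStep-∘ false true  true  _ _ _ = trans assoc (cong (ρ⇒ ∘_) (trans ∘-⊗ (cong (_ ⊗₁_) identityʳ)))
    margStep-∘ false true  false _ ptu _ with () ← ptu refl
    margStep-∘ false false true  _ _ _ =
      trans (pullˡ (sym ρ-nat)) (trans assoc (cong (ρ⇒ ∘_) (trans ∘-⊗ (cong (_ ⊗₁_) identityˡ))))
    margStep-∘ false false false _ _ _ = refl

  marg-irrelevant : ∀ {n} {ob : Fin n → Obj} (S T : Fin n → Bool) p p' →
                    marg {ob = ob} S T p ≡ marg S T p'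
  marg-irrelevant {zero}  S T p p' = refl
  marg-irrelevant {suc n} S T p p' =
    margStep-irrelevant (S zero) (T zero) (p zero) (p' zero)
      (marg-irrelevant (λ i → S (suc i)) (λ i → T (suc i)) (λ i → p (suc i)) (λ i → p' (suc i)))
    where
    margStep-irrelevant : ∀ {A B X} {f f' : A ⇒ B} (s t : Bool) p p' →
                          f ≡ f' → margStep {X = X} s t p f ≡ margStep s t p' f'
    margStep-irrelevant true  true  _ _  refl = refl
    margStep-irrelevant true  false p _  _ with () ← p refl
    margStep-irrelevant false true  _ _  refl = refl
    margStep-irrelevant false false _ _  refl = refl

  marg-deterministic : ∀ {n} {ob : Fin n → Obj} (S T : Fin n → Bool) p →
                       Deterministic (marg {ob = ob} S T p)
  marg-deterministic {zero}  S T p = Deterministic-id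
  marg-deterministic {suc n} S T p =
    margStep-deterministic (S zero) (T zero) (p zero)
      (marg-deterministic (λ i → S (suc i)) (λ i → T (suc i)) (λ i → p (suc i)))
    where
    margStep-deterministic : ∀ {A B X} {f : A ⇒ B} (s t : Bool) p →
                             Deterministic f → Deterministic (margStep {X = X} s t p f)
    margStep-deterministic true  true  _ df = Deterministic-⊗ df Deterministic-id
    margStep-deterministic true  false p _  with () ← p refl
    margStep-deterministic false true  _ df =
      Deterministic-∘ Deterministic-ρ⇒ (Deterministic-⊗ df Deterministic-ε)
    margStep-deterministic false false _ df = df

  marg-channel : ∀ {n} {ob : Fin n → Obj} (S T : Fin n → Bool) p → IsChannel (marg {ob = ob} S T p)
  marg-channel {zero}  S T p = IsChannel-id
  marg-channel {suc n} S T p =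
    margStep-channel (S zero) (T zero) (p zero)
      (marg-channel (λ i → S (suc i)) (λ i → T (suc i)) (λ i → p (suc i)))
    where
    margStep-channel : ∀ {A B X} {f : A ⇒ B} (s t : Bool) p →
                       IsChannel f → IsChannel (margStep {X = X} s t p f)
    margStep-channel true  true  _ cf = IsChannel-⊗ cf IsChannel-id
    margStep-channel true  false p _  with () ← p refl
    margStep-channel false true  _ cf = IsChannel-∘ IsChannel-ρ⇒ (IsChannel-⊗ cf IsChannel-ε)
    margStep-channel false false _ cf = cf

  split-marginal-newest : ∀ {n} {ob : Fin (suc n) → Obj} (M : Mechanisms n (λ i → ob (suc i)))
    (pa : Fin n → Bool) (c : X[ pa ] (λ i → ob (suc i)) ⇒ ob zero) (ch : IsChannel c) (pP : pa ⊆ full) →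
    let M′ = snoc {ob = ob} M pa c ch in
    (pS : (single zero ∪ Pa M′ zero) ⊆ full) (d : Disjoint (single zero) (Pa M′ zero)) →
    split {ob = ob} (single zero) (Pa M′ zero) d ∘ marg {ob = ob} (single zero ∪ Pa M′ zero) full pS ∘ joint M′
      ≡ (insertˡ (emptyState (λ i → ob (suc i))) ⊗₁ id) ∘ (c ⊗₁ id) ∘ Δ ∘ marg pa full pP ∘ joint M
  split-marginal-newest {ob = ob} M pa c ch pP pS d = begin
    splitStep true false (d zero) (split (λ _ → false) pa _) ∘ (marg pa full _ ⊗₁ id) ∘ (id ⊗₁ (c ∘ m₀)) ∘ Δ ∘ joint M
      ≡⟨ cong₂ (λ s t → s ∘ (t ⊗₁ id) ∘ (id ⊗₁ (c ∘ m₀)) ∘ Δ ∘ joint M)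
           (trans (cong (splitStep true false (d zero)) (split-∅ pa _)) (splitStep-insertˡ (d zero)))
           (marg-irrelevant pa full _ _) ⟩
    (z⊗id ∘ σ) ∘ (m ⊗₁ id) ∘ (id ⊗₁ (c ∘ m₀)) ∘ Δ ∘ joint M
      ≡⟨ cong (λ t → (z⊗id ∘ σ) ∘ (m ⊗₁ id) ∘ (id ⊗₁ (c ∘ t)) ∘ Δ ∘ joint M) (marg-irrelevant pa full _ _) ⟩
    (z⊗id ∘ σ) ∘ (m ⊗₁ id) ∘ (id ⊗₁ (c ∘ m)) ∘ Δ ∘ joint M
      ≡⟨ cong ((z⊗id ∘ σ) ∘_) (trans (cong ((m ⊗₁ id) ∘_) (sym assoc))
                                      (pullˡ (Deterministic⇒graph (marg-deterministic pa full _)))) ⟩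
    (z⊗id ∘ σ) ∘ ((id ⊗₁ c) ∘ Δ ∘ m) ∘ joint M
      ≡⟨ cong ((z⊗id ∘ σ) ∘_) (trans (cong (_∘ joint M) (sym assoc)) assoc) ⟩
    (z⊗id ∘ σ) ∘ ((id ⊗₁ c) ∘ Δ) ∘ m ∘ joint M
      ≡⟨ trans assoc (cong (z⊗id ∘_) (trans (pullˡ σ∘graph) assoc)) ⟩
    z⊗id ∘ (c ⊗₁ id) ∘ Δ ∘ m ∘ joint M ∎
    where
    tl : Fin _ → Obj
    tl i = ob (suc i)
    z⊗id : ob zero ⊗₀ X[ pa ] tl ⇒ (X[ (λ _ → false) ] tl ⊗₀ ob zero) ⊗₀ X[ pa ] tl
    z⊗id = insertˡ (emptyState tl) ⊗₁ id
    m m₀ : X[ full ] tl ⇒ X[ pa ] tl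
    m  = marg pa full pP
    m₀ = marg pa full (λ _ _ → refl)

  -- A later vertex is a channel, so discarding it leaves the relevant marginals unchanged.
  mech≡conditional : ∀ {n} {ob : Fin n → Obj} (M : Mechanisms n ob) (x : Fin n)
    (pP : Pa M x ⊆ full) (pS : (single x ∪ Pa M x) ⊆ full) (d : Disjoint (single x) (Pa M x)) →
    HasFullSupport (marg (Pa M x) full pP ∘ joint M) →
    mech M x ≡ unsingle x ∘ norm (capped (split (single x) (Pa M x) d ∘ marg (single x ∪ Pa M x) full pS ∘ joint M))
  mech≡conditional {suc n} {ob} M′@(snoc M pa c ch) zero pP pS d fullP = begin
    c
      ≡⟨ sym (trans (sym assoc) (trans (cong (_∘ c) unsingle∘insertˡ) identityˡ)) ⟩
    unsingle₀ ∘ insertˡ z ∘ c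
      ≡⟨ cong (λ t → unsingle₀ ∘ insertˡ z ∘ t) (sym (norm-capped-graph fullQ ch)) ⟩
    unsingle₀ ∘ insertˡ z ∘ norm (capped graph)
      ≡⟨ cong (unsingle₀ ∘_) (sym (trans (cong norm capped-natural) (norm-insertˡ (ε∘emptyState tl)))) ⟩
    unsingle₀ ∘ norm (capped ((insertˡ z ⊗₁ id) ∘ graph))
      ≡⟨ cong (λ s → unsingle₀ ∘ norm (capped s)) (sym (split-marginal-newest M pa c ch _ pS d)) ⟩
    unsingle₀ ∘ norm (capped (split {ob = ob} (single zero) _ d ∘ marg {ob = ob} _ full pS ∘ joint M′)) ∎
    where
    unsingle₀ : X[ single zero ] ob ⇒ ob zero
    unsingle₀ = unsingle {ob = ob} zero
    tl : Fin n → Obj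
    tl i = ob (suc i)
    z : unit ⇒ X[ (λ _ → false) ] tl
    z = emptyState tl
    q : unit ⇒ X[ pa ] tl
    q = marg pa full (λ i → pP (suc i)) ∘ joint M
    graph : unit ⇒ ob zero ⊗₀ X[ pa ] tl
    graph = (c ⊗₁ id) ∘ Δ ∘ q
    fullQ : HasFullSupport q
    fullQ = subst HasFullSupport (marginal-of-extension (IsChannel-∘ ch (marg-channel pa full _))) fullP
    unsingle∘insertˡ : unsingle₀ ∘ insertˡ z ≡ id
    unsingle∘insertˡ = trans (cong (λ e → (λ⇒ ∘ (e ⊗₁ id)) ∘ insertˡ z) (empty⇒unit≡ε tl))
                             (λ⇒∘[e⊗id]∘insertˡ (ε∘emptyState tl))
  mech≡conditional (snoc M pa c ch) (suc j) pP pS d fullP =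
    trans (mech≡conditional M j (λ i → pP (suc i)) (λ i → pS (suc i)) (λ i → d (suc i))
             (subst HasFullSupport (marginal-of-extension extension-channel) fullP))
          (cong (λ t → unsingle j ∘ norm (capped (split (single j) (Pa M j) (λ i → d (suc i)) ∘ t)))
                (sym (marginal-of-extension extension-channel)))
    where
    extension-channel : IsChannel (c ∘ marg pa full _)
    extension-channel = IsChannel-∘ ch (marg-channel pa full _)

lemma3p22 : ∀ {o ℓ} (C : SymMonCat o ℓ) (D : IsCD C) (E : EffectConditioning C D)
              (M : Causal.CausalModel C D) →
            let open SymMonCat C
                open Causal.CausalModel M
                open Conditioning C D E M
            in (x : Fin n) →
               (sub : (single x ∪ Parents x) ⊆ out) →
               FullSupport (Parents x) (∪-⊆ʳ sub) →
               c x ≡ Causal.unsingle C D x ∘ cond (single x) (Parents x)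
                       (Causal.single-Pa-disjoint C D mechs x) sub
lemma3p22 C D E M x sub fullP =
  trans (mech≡conditional mechs x _ _ d (subst HasFullSupport (marginal-via-out (∪-⊆ʳ sub)) fullP))
        (cong (λ t → unsingle x ∘ norm (capped (split (single x) (Pa mechs x) d ∘ t)))
              (sym (marginal-via-out sub)))
  where
  open SymMonCat C
  open EffectConditioning E using (norm)
  open Causal C D
  open CausalModel M
  open Conditionals C D E using (capped; HasFullSupport)
  open MechanismsAsConditionals C D E using (mech≡conditional; marg-∘)
  d : Disjoint (single x) (Pa mechs x)
  d = single-Pa-disjoint mechs x
  marginal-via-out : ∀ {T} (p : T ⊆ out) →
                     marg T out p ∘ marg out full (λ _ _ → refl) ∘ joint mechs ≡ marg T full (λ _ _ → refl) ∘ joint mechs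
  marginal-via-out {T} p = trans (sym assoc) (cong (_∘ joint mechs) (marg-∘ T out full p _ _))
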